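{- Let $F=\mathbb{F}_q$ with $q$ odd, and let $\rho$ be a nontrivial automorphism of $F$ such that $-1\notin\{x^{\rho-1}\mid x\in F^*\}$. Let $\alpha:F\to F$, $\alpha(u)=u^{\rho^{ -1}}+u^{\rho}$, let $\beta=\alpha^{ -1}$, and let $t$ be the order of $\rho$. Then $$\beta(v)=\tfrac12\left(a_0v+a_1v^{\rho}+\cdots+a_{t-1}v^{\rho^{t-1}}\right),$$ where, for all $i\ge 0$: if $t\equiv 1\pmod 4$ then $a_{4i}=a_{4i+1}=1$ and $a_{4i+2}=a_{4i+3}=-1$; if $t\equiv 3\pmod 4$ then $a_{4i}=a_{4i+3}=-1$ and $a_{4i+1}=a_{4i+2}=1$.
   Context: $x^{\rho^k}$ denotes the image of $x$ under $\rho^k$, and $x^{\rho-1}=x^{\rho}/x$. -}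

module Defs where

open import Level using (Level; _⊔_)
open import Data.Nat using (ℕ; zero; suc; _%_; _<_)
open import Data.Bool using (Bool; true; false; if_then_else_)
open import Data.Fin using (Fin)
open import Data.Product using (Σ; ∃; _×_)
open import Relation.Nullary using (¬_)
open import Relation.Binary.PropositionalEquality as ≡ using (_≡_)
open import Algebra.Bundles using (CommutativeRing)
open import Algebra.Morphism.Structures using (module RingMorphisms)
open import Function.Bundles using (Bijection)

record FiniteField (c ℓ : Level) (q : ℕ) : Set (Level.suc (c ⊔ ℓ)) where
  field
    cring     : CommutativeRing c ℓ
  open CommutativeRing cring public
  field
    1≉0       : ¬ (1# ≈ 0#)
    _⁻¹       : (x : Carrier) → ¬ (x ≈ 0#) → Carrier
    inverseʳ  : (x : Carrier) (nz : ¬ (x ≈ 0#)) → x * (x ⁻¹) nz ≈ 1#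
    finite    : Bijection setoid (≡.setoid (Fin q))

module _ {c ℓ : Level} {q : ℕ} (F : FiniteField c ℓ q) where
  open FiniteField F
  open RingMorphisms (CommutativeRing.rawRing cring) (CommutativeRing.rawRing cring)

  record Automorphism : Set (c ⊔ ℓ) where
    field
      ρ     : Carrier → Carrier
      ρ⁻¹   : Carrier → Carrier
      isHom : IsRingHomomorphism ρ
      invˡ  : ∀ x → ρ⁻¹ (ρ x) ≈ x
      invʳ  : ∀ x → ρ (ρ⁻¹ x) ≈ x

  iter : ℕ → (Carrier → Carrier) → Carrier → Carrier
  iter zero    f x = x
  iter (suc k) f x = f (iter k f x)

  IsOrder : (Carrier → Carrier) → ℕ → Set (c ⊔ ℓ)
  IsOrder f t = (0 < t) × (∀ x → iter t f x ≈ x)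
              × (∀ s → 0 < s → s < t → ¬ (∀ x → iter s f x ≈ x))

  sumTo : ℕ → (ℕ → Carrier) → Carrier
  sumTo zero    g = 0#
  sumTo (suc n) g = sumTo n g + g n

  pos : ℕ → ℕ → Bool
  pos 1 0 = true
  pos 1 1 = true
  pos 3 1 = true
  pos 3 2 = true
  pos _ _ = false

  -- the coefficient a_i (for t ≡ 1 or 3 mod 4; for even t it is unused)
  coeff : ℕ → ℕ → Carrier
  coeff t i = if pos (t % 4) (i % 4) then 1# else - 1#

  formulaSum : (Carrier → Carrier) → ℕ → Carrier → Carrier
  formulaSum f t v = sumTo t (λ i → coeff t i * iter i f v)

-- Write S v = Σ_{i<t} a_i v^{ρ^i}.  For odd t the sign pattern is exactly what makes
-- a_{i+2} = -a_i, a_1 = 1, a_t = a_0 and a_{t+1} = -1; since ρ fixes every a_i, the sum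
-- S v + (S v)^{ρ²} then telescopes to 2 v^ρ.  As α(u)^ρ = u + u^{ρ²}, this says that S ∘ α
-- and α ∘ S are multiplication by 2 after applying ρ, which is injective.
-- The order t is odd: otherwise the alternating sum y - y^ρ + y^{ρ²} - ... is negated by ρ,
-- so by hypothesis it vanishes for every y, contradicting Dedekind's independence of the
-- distinct automorphisms ρ^i (i < t).  Finally 2 ≠ 0 because 1^{ρ-1} = 1 ≠ -1.
module Submission where

open import Defs
open import Level using (Level)
open import Data.Nat using (ℕ; zero; suc; _%_; _<_; _∸_)
import Data.Nat as ℕ
open import Data.Nat.Properties
  using (≤-refl; <⇒≤; ≤-<-trans; m<n⇒m<1+n; m<1+n⇒m<n∨m≡n; m<n⇒0<n∸m; m∸n≤m; m+[n∸m]≡n)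
open import Data.Bool using (Bool; true; false; not; if_then_else_)
open import Data.Product using (Σ; _×_; _,_; proj₁; proj₂)
open import Data.Sum using (_⊎_; inj₁; inj₂)
open import Data.Empty using (⊥-elim)
import Data.Fin.Properties as Fin
open import Function using (_∘_)
open import Function.Bundles using (module Bijection)
open import Relation.Nullary using (¬_; yes; no)
open import Relation.Nullary.Decidable using (decidable-stable)
open import Relation.Binary.Definitions using (Decidable)
open import Relation.Binary.PropositionalEquality as ≡ using (_≡_)
open import Algebra.Bundles using (CommutativeRing)
open import Algebra.Morphism.Structures using (module RingMorphisms)

parity : ∀ n → n % 2 ≡ 0 ⊎ n % 2 ≡ 1
parity zero          = inj₁ ≡.refl
parity (suc zero)    = inj₂ ≡.refl
parity (suc (suc n)) = parity n

module FieldProperties {c ℓ : Level} {q : ℕ} (F : FiniteField c ℓ q) where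
  open FiniteField F
  open import Algebra.Properties.Ring ring public
  open import Algebra.Properties.CommutativeSemigroup *-commutativeSemigroup using (x∙yz≈y∙xz)
  open import Algebra.Properties.CommutativeSemigroup +-commutativeSemigroup
    using () renaming (interchange to +-interchange)
  open import Relation.Binary.Reasoning.Setoid setoid public

  infix 4 _≟_
  _≟_ : Decidable _≈_
  x ≟ y with Bijection.to finite x Fin.≟ Bijection.to finite y
  ... | yes e = yes (Bijection.injective finite e)
  ... | no ne = no (ne ∘ Bijection.cong finite)

  x≉0⇒x*y≈0⇒y≈0 : ∀ {x y} (x≉0 : ¬ (x ≈ 0#)) → x * y ≈ 0# → y ≈ 0#
  x≉0⇒x*y≈0⇒y≈0 {x} {y} x≉0 xy≈0 = begin
    y                     ≈⟨ *-identityˡ y ⟨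
    1# * y                ≈⟨ *-congʳ (trans (*-comm _ _) (inverseʳ x x≉0)) ⟨
    ((x ⁻¹) x≉0 * x) * y  ≈⟨ *-assoc _ x y ⟩
    (x ⁻¹) x≉0 * (x * y)  ≈⟨ *-congˡ xy≈0 ⟩
    (x ⁻¹) x≉0 * 0#       ≈⟨ zeroʳ _ ⟩
    0#                    ∎

  inverse-unique : ∀ {x y} (x≉0 : ¬ (x ≈ 0#)) → y * x ≈ 1# → y ≈ (x ⁻¹) x≉0
  inverse-unique {x} {y} x≉0 yx≈1 = begin
    y                     ≈⟨ *-identityʳ y ⟨
    y * 1#                ≈⟨ *-congˡ (inverseʳ x x≉0) ⟨
    y * (x * (x ⁻¹) x≉0)  ≈⟨ *-assoc y x _ ⟨
    (y * x) * (x ⁻¹) x≉0  ≈⟨ *-congʳ yx≈1 ⟩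
    1# * (x ⁻¹) x≉0       ≈⟨ *-identityˡ _ ⟩
    (x ⁻¹) x≉0            ∎

  x-y+y-z≈x-z : ∀ x y z → (x - y) + (y - z) ≈ x - z
  x-y+y-z≈x-z x y z = begin
    (x - y) + (y - z)    ≈⟨ +-assoc x (- y) (y - z) ⟩
    x + (- y + (y - z))  ≈⟨ +-congˡ (+-assoc (- y) y (- z)) ⟨
    x + ((- y + y) - z)  ≈⟨ +-congˡ (+-congʳ (-‿inverseˡ y)) ⟩
    x + (0# - z)         ≈⟨ +-congˡ (+-identityˡ (- z)) ⟩
    x - z                ∎

  ∑ : ℕ → (ℕ → Carrier) → Carrier
  ∑ = sumTo F

  ∑-cong : ∀ n {f g : ℕ → Carrier} → (∀ i → f i ≈ g i) → ∑ n f ≈ ∑ n g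
  ∑-cong zero    f≈g = refl
  ∑-cong (suc n) f≈g = +-cong (∑-cong n f≈g) (f≈g n)

  ∑-zero : ∀ n {f : ℕ → Carrier} → (∀ i → i < n → f i ≈ 0#) → ∑ n f ≈ 0#
  ∑-zero zero    f≈0 = refl
  ∑-zero (suc n) f≈0 =
    trans (+-cong (∑-zero n (λ i → f≈0 i ∘ m<n⇒m<1+n)) (f≈0 n ≤-refl)) (+-identityˡ 0#)

  ∑-+ : ∀ n (f g : ℕ → Carrier) → ∑ n (λ i → f i + g i) ≈ ∑ n f + ∑ n g
  ∑-+ zero    f g = sym (+-identityˡ 0#)
  ∑-+ (suc n) f g = trans (+-congʳ (∑-+ n f g)) (+-interchange _ _ _ _)

  ∑-* : ∀ n k (f : ℕ → Carrier) → ∑ n (λ i → k * f i) ≈ k * ∑ n f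
  ∑-* zero    k f = sym (zeroʳ k)
  ∑-* (suc n) k f = trans (+-congʳ (∑-* n k f)) (sym (distribˡ k _ _))

  ∑-telescope : ∀ n (f : ℕ → Carrier) → ∑ n (λ i → f i - f (suc i)) ≈ f 0 - f n
  ∑-telescope zero    f = sym (-‿inverseʳ (f 0))
  ∑-telescope (suc n) f = trans (+-congʳ (∑-telescope n f)) (x-y+y-z≈x-z _ _ _)

  ∑-telescope₂ : ∀ n (f : ℕ → Carrier) →
    ∑ n (λ i → f i - f (suc (suc i))) ≈ (f 0 - f n) + (f 1 - f (suc n))
  ∑-telescope₂ n f = begin
    ∑ n (λ i → f i - f (suc (suc i)))
      ≈⟨ ∑-cong n (λ i → sym (x-y+y-z≈x-z _ _ _)) ⟩
    ∑ n (λ i → (f i - f (suc i)) + (f (suc i) - f (suc (suc i))))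
      ≈⟨ ∑-+ n _ _ ⟩
    ∑ n (λ i → f i - f (suc i)) + ∑ n (λ i → f (suc i) - f (suc (suc i)))
      ≈⟨ +-cong (∑-telescope n f) (∑-telescope n (f ∘ suc)) ⟩
    (f 0 - f n) + (f 1 - f (suc n))
      ∎

  module _ (τ : ℕ → Carrier → Carrier)
           (τ-* : ∀ i x y → τ i (x * y) ≈ τ i x * τ i y)
           (τ-1 : ∀ i → τ i 1# ≈ 1#) where

    dedekindIndependence : ∀ n → (∀ i j → i < j → j < n → ¬ (∀ x → τ i x ≈ τ j x)) →
      (a : ℕ → Carrier) → (∀ x → ∑ n (λ i → a i * τ i x) ≈ 0#) → ∀ j → j < n → a j ≈ 0#
    dedekindIndependence zero    _        _ _        _ ()
    dedekindIndependence (suc m) distinct a relation = vanish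
      where
        top-term : ∀ x → ∑ m (λ i → a i * τ i x) ≈ - (a m * τ m x)
        top-term x = +-inverseˡ-unique _ _ (relation x)

        -- relation at y * x minus τ m y times relation at x: the top term cancels
        shorter : ∀ y x → ∑ m (λ i → a i * (τ i y - τ m y) * τ i x) ≈ 0#
        shorter y x = begin
          ∑ m (λ i → a i * (τ i y - τ m y) * τ i x)
            ≈⟨ ∑-cong m (λ i → expand (a i) (τ i y) (τ m y) (τ i x) (τ-* i y x)) ⟩
          ∑ m (λ i → a i * τ i (y * x) + (- τ m y) * (a i * τ i x))
            ≈⟨ trans (∑-+ m _ _) (+-congˡ (∑-* m _ _)) ⟩
          ∑ m (λ i → a i * τ i (y * x)) + (- τ m y) * ∑ m (λ i → a i * τ i x)
            ≈⟨ +-cong (top-term (y * x)) (*-congˡ (top-term x)) ⟩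
          - (a m * τ m (y * x)) + (- τ m y) * - (a m * τ m x)
            ≈⟨ cancel (a m) (τ m y) (τ m x) (τ-* m y x) ⟩
          0# ∎
          where
            expand : ∀ b p s z {w} → w ≈ p * z → b * (p - s) * z ≈ b * w + (- s) * (b * z)
            expand b p s z {w} w≈pz = begin
              b * (p - s) * z            ≈⟨ *-assoc b _ z ⟩
              b * ((p - s) * z)          ≈⟨ *-congˡ ([y-z]x≈yx-zx z p s) ⟩
              b * (p * z - s * z)        ≈⟨ x[y-z]≈xy-xz b _ _ ⟩
              b * (p * z) - b * (s * z)  ≈⟨ +-cong (*-congˡ (sym w≈pz)) (-‿cong (x∙yz≈y∙xz b s z)) ⟩
              b * w - s * (b * z)        ≈⟨ +-congˡ (-‿distribˡ-* s _) ⟩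
              b * w + (- s) * (b * z)    ∎
            cancel : ∀ b s z {w} → w ≈ s * z → - (b * w) + (- s) * - (b * z) ≈ 0#
            cancel b s z {w} w≈sz = begin
              - (b * w) + (- s) * - (b * z)  ≈⟨ +-congˡ (-‿distribˡ-* s _) ⟨
              - (b * w) - s * - (b * z)      ≈⟨ +-congˡ (-‿cong (-‿distribʳ-* s _)) ⟨
              - (b * w) - - (s * (b * z))    ≈⟨ +-congˡ (-‿involutive _) ⟩
              - (b * w) + s * (b * z)        ≈⟨ +-congˡ (x∙yz≈y∙xz s b z) ⟩
              - (b * w) + b * (s * z)        ≈⟨ +-congʳ (-‿cong (*-congˡ w≈sz)) ⟩
              - (b * (s * z)) + b * (s * z)  ≈⟨ -‿inverseˡ _ ⟩
              0#                             ∎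

        lower : ∀ j → j < m → a j ≈ 0#
        lower j j<m = decidable-stable (a j ≟ 0#) λ aj≉0 →
          distinct j m j<m ≤-refl λ y → x∙y⁻¹≈ε⇒x≈y _ _ (x≉0⇒x*y≈0⇒y≈0 aj≉0
            (dedekindIndependence m (λ i k i<k → distinct i k i<k ∘ m<n⇒m<1+n)
              (λ i → a i * (τ i y - τ m y)) (shorter y) j j<m))

        top : a m ≈ 0#
        top = begin
          a m                                        ≈⟨ *-identityʳ (a m) ⟨
          a m * 1#                                   ≈⟨ *-congˡ (τ-1 m) ⟨
          a m * τ m 1#                               ≈⟨ +-identityˡ _ ⟨
          0# + a m * τ m 1#                          ≈⟨ +-congʳ (∑-zero m (λ i i<m → trans (*-congʳ (lower i i<m)) (zeroˡ _))) ⟨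
          ∑ m (λ i → a i * τ i 1#) + a m * τ m 1#    ≈⟨ relation 1# ⟩
          0#                                         ∎

        vanish : ∀ j → j < suc m → a j ≈ 0#
        vanish j j<1+m with m<1+n⇒m<n∨m≡n j<1+m
        ... | inj₁ j<m     = lower j j<m
        ... | inj₂ ≡.refl  = top

  altSign : ℕ → Carrier
  altSign zero    = 1#
  altSign (suc i) = - altSign i

  altSign-even : ∀ n → n % 2 ≡ 0 → altSign n ≈ 1#
  altSign-even zero          _     = refl
  altSign-even (suc zero)    ()
  altSign-even (suc (suc n)) n-even = trans (-‿involutive _) (altSign-even n n-even)

  sign : Bool → Carrier
  sign b = if b then 1# else - 1#

  sign-not : ∀ b → sign (not b) ≈ - sign b
  sign-not true  = refl
  sign-not false = sym (-‿involutive 1#)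

  coeff-1 : ∀ t → t % 2 ≡ 1 → coeff F t 1 ≈ 1#
  coeff-1 zero                         ()
  coeff-1 (suc zero)                   _     = refl
  coeff-1 (suc (suc zero))             ()
  coeff-1 (suc (suc (suc zero)))       _     = refl
  coeff-1 (suc (suc (suc (suc t))))    t-odd = coeff-1 t t-odd

  coeff-t : ∀ t → t % 2 ≡ 1 → coeff F t t ≈ coeff F t 0
  coeff-t zero                         ()
  coeff-t (suc zero)                   _     = refl
  coeff-t (suc (suc zero))             ()
  coeff-t (suc (suc (suc zero)))       _     = refl
  coeff-t (suc (suc (suc (suc t))))    t-odd = coeff-t t t-odd

  coeff-1+t : ∀ t → t % 2 ≡ 1 → coeff F t (suc t) ≈ - 1#
  coeff-1+t zero                       ()
  coeff-1+t (suc zero)                 _     = refl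
  coeff-1+t (suc (suc zero))           ()
  coeff-1+t (suc (suc (suc zero)))     _     = refl
  coeff-1+t (suc (suc (suc (suc t))))  t-odd = coeff-1+t t t-odd

  pos-2+ : ∀ t → t % 2 ≡ 1 → ∀ i → pos F (t % 4) (suc (suc i) % 4) ≡ not (pos F (t % 4) (i % 4))
  pos-2+ zero                      ()
  pos-2+ (suc zero)                _     = flip₁
    where
      flip₁ : ∀ i → pos F 1 (suc (suc i) % 4) ≡ not (pos F 1 (i % 4))
      flip₁ zero                      = ≡.refl
      flip₁ (suc zero)                = ≡.refl
      flip₁ (suc (suc zero))          = ≡.refl
      flip₁ (suc (suc (suc zero)))    = ≡.refl
      flip₁ (suc (suc (suc (suc i)))) = flip₁ i
  pos-2+ (suc (suc zero))          ()
  pos-2+ (suc (suc (suc zero)))    _     = flip₃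
    where
      flip₃ : ∀ i → pos F 3 (suc (suc i) % 4) ≡ not (pos F 3 (i % 4))
      flip₃ zero                      = ≡.refl
      flip₃ (suc zero)                = ≡.refl
      flip₃ (suc (suc zero))          = ≡.refl
      flip₃ (suc (suc (suc zero)))    = ≡.refl
      flip₃ (suc (suc (suc (suc i)))) = flip₃ i
  pos-2+ (suc (suc (suc (suc t)))) t-odd = pos-2+ t t-odd

  coeff-2+ : ∀ t → t % 2 ≡ 1 → ∀ i → coeff F t (suc (suc i)) ≈ - coeff F t i
  coeff-2+ t t-odd i = trans (reflexive (≡.cong sign (pos-2+ t t-odd i))) (sign-not _)

module AutomorphismProperties {c ℓ : Level} {q : ℕ} {F : FiniteField c ℓ q} (A : Automorphism F) where
  open FiniteField F
  open Automorphism A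
  open FieldProperties F
  open RingMorphisms (CommutativeRing.rawRing cring) (CommutativeRing.rawRing cring)
  open IsRingHomomorphism isHom

  ρ^_ : ℕ → Carrier → Carrier
  ρ^ k = iter F k ρ

  ρ^-cong : ∀ k {x y} → x ≈ y → (ρ^ k) x ≈ (ρ^ k) y
  ρ^-cong zero    x≈y = x≈y
  ρ^-cong (suc k) x≈y = ⟦⟧-cong (ρ^-cong k x≈y)

  ρ^-* : ∀ k x y → (ρ^ k) (x * y) ≈ (ρ^ k) x * (ρ^ k) y
  ρ^-* zero    x y = refl
  ρ^-* (suc k) x y = trans (⟦⟧-cong (ρ^-* k x y)) (*-homo _ _)

  ρ^-+ : ∀ k x y → (ρ^ k) (x + y) ≈ (ρ^ k) x + (ρ^ k) y
  ρ^-+ zero    x y = refl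
  ρ^-+ (suc k) x y = trans (⟦⟧-cong (ρ^-+ k x y)) (+-homo _ _)

  ρ^-1 : ∀ k → (ρ^ k) 1# ≈ 1#
  ρ^-1 zero    = refl
  ρ^-1 (suc k) = trans (⟦⟧-cong (ρ^-1 k)) 1#-homo

  ρ^-ρ : ∀ k x → (ρ^ k) (ρ x) ≡ ρ ((ρ^ k) x)
  ρ^-ρ zero    x = ≡.refl
  ρ^-ρ (suc k) x = ≡.cong ρ (ρ^-ρ k x)

  ρ^-+-index : ∀ k i x → (ρ^ (k ℕ.+ i)) x ≡ (ρ^ k) ((ρ^ i) x)
  ρ^-+-index zero    i x = ≡.refl
  ρ^-+-index (suc k) i x = ≡.cong ρ (ρ^-+-index k i x)

  ρ-∑ : ∀ n (f : ℕ → Carrier) → ρ (∑ n f) ≈ ∑ n (ρ ∘ f)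
  ρ-∑ zero    f = 0#-homo
  ρ-∑ (suc n) f = trans (+-homo _ _) (+-congʳ (ρ-∑ n f))

  ρ-altSign : ∀ i → ρ (altSign i) ≈ altSign i
  ρ-altSign zero    = 1#-homo
  ρ-altSign (suc i) = trans (-‿homo _) (-‿cong (ρ-altSign i))

  ρ-sign : ∀ b → ρ (sign b) ≈ sign b
  ρ-sign true  = 1#-homo
  ρ-sign false = trans (-‿homo 1#) (-‿cong 1#-homo)

  ρ-inverse : ∀ {x} (x≉0 : ¬ (x ≈ 0#)) → ρ x ≈ x → ρ ((x ⁻¹) x≉0) ≈ (x ⁻¹) x≉0
  ρ-inverse {x} x≉0 ρx≈x = inverse-unique x≉0 (begin
    ρ ((x ⁻¹) x≉0) * x      ≈⟨ *-congˡ ρx≈x ⟨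
    ρ ((x ⁻¹) x≉0) * ρ x    ≈⟨ *-homo _ x ⟨
    ρ ((x ⁻¹) x≉0 * x)      ≈⟨ ⟦⟧-cong (trans (*-comm _ x) (inverseʳ x x≉0)) ⟩
    ρ 1#                    ≈⟨ 1#-homo ⟩
    1#                      ∎)

  ρx≈-x⇒x≈0 : (∀ x (x≉0 : ¬ (x ≈ 0#)) → ¬ (ρ x * (x ⁻¹) x≉0 ≈ - 1#)) → ∀ x → ρ x ≈ - x → x ≈ 0#
  ρx≈-x⇒x≈0 no-ratio-1 x ρx≈-x = decidable-stable (x ≟ 0#) λ x≉0 → no-ratio-1 x x≉0 (begin
    ρ x * (x ⁻¹) x≉0     ≈⟨ *-congʳ ρx≈-x ⟩
    - x * (x ⁻¹) x≉0     ≈⟨ -‿distribˡ-* x _ ⟨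
    - (x * (x ⁻¹) x≉0)   ≈⟨ -‿cong (inverseʳ x x≉0) ⟩
    - 1#                 ∎)

  1+1≉0 : (∀ x → ρ x ≈ - x → x ≈ 0#) → ¬ (1# + 1# ≈ 0#)
  1+1≉0 ρx≈-x⇒x≈0 2≈0 = 1≉0 (ρx≈-x⇒x≈0 1# (trans 1#-homo (+-inverseˡ-unique 1# 1# 2≈0)))

  ρ-injective : ∀ {t} → IsOrder F ρ t → ∀ {x y} → ρ x ≈ ρ y → x ≈ y
  ρ-injective {suc m} (_ , period , _) {x} {y} ρx≈ρy = begin
    x                ≈⟨ period x ⟨
    ρ ((ρ^ m) x)     ≡⟨ ρ^-ρ m x ⟨
    (ρ^ m) (ρ x)     ≈⟨ ρ^-cong m ρx≈ρy ⟩
    (ρ^ m) (ρ y)     ≡⟨ ρ^-ρ m y ⟩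
    ρ ((ρ^ m) y)     ≈⟨ period y ⟩
    y                ∎

  module Order {t : ℕ} (order : IsOrder F ρ t) where
    period : ∀ x → (ρ^ t) x ≈ x
    period = proj₁ (proj₂ order)

    ρ^-injective : ∀ k {x y} → (ρ^ k) x ≈ (ρ^ k) y → x ≈ y
    ρ^-injective zero    ρ^kx≈ρ^ky = ρ^kx≈ρ^ky
    ρ^-injective (suc k) ρ^kx≈ρ^ky = ρ^-injective k (ρ-injective order ρ^kx≈ρ^ky)

    ρ^-distinct : ∀ i j → i < j → j < t → ¬ (∀ x → (ρ^ i) x ≈ (ρ^ j) x)
    ρ^-distinct i j i<j j<t ρ^i≗ρ^j =
      proj₂ (proj₂ order) (j ∸ i) (m<n⇒0<n∸m i<j) (≤-<-trans (m∸n≤m j i) j<t) λ x →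
        ρ^-injective i (begin
          (ρ^ i) ((ρ^ (j ∸ i)) x)  ≡⟨ ρ^-+-index i (j ∸ i) x ⟨
          (ρ^ (i ℕ.+ (j ∸ i))) x   ≡⟨ ≡.cong (λ k → (ρ^ k) x) (m+[n∸m]≡n (<⇒≤ i<j)) ⟩
          (ρ^ j) x                 ≈⟨ ρ^i≗ρ^j x ⟨
          (ρ^ i) x                 ∎)

    alternatingSum : Carrier → Carrier
    alternatingSum y = ∑ t (λ i → altSign i * (ρ^ i) y)

    ρ-alternatingSum : t % 2 ≡ 0 → ∀ y → ρ (alternatingSum y) ≈ - alternatingSum y
    ρ-alternatingSum t-even y = +-inverseʳ-unique (∑ t f) _ (begin
      ∑ t f + ρ (∑ t f)             ≈⟨ +-congˡ (ρ-∑ t f) ⟩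
      ∑ t f + ∑ t (ρ ∘ f)           ≈⟨ ∑-+ t f (ρ ∘ f) ⟨
      ∑ t (λ i → f i + ρ (f i))     ≈⟨ ∑-cong t (λ i → +-congˡ (ρ-term i)) ⟩
      ∑ t (λ i → f i - f (suc i))   ≈⟨ ∑-telescope t f ⟩
      f 0 - f t                     ≈⟨ x≈y⇒x∙y⁻¹≈ε (*-cong (sym (altSign-even t t-even)) (sym (period y))) ⟩
      0#                            ∎)
      where
        f : ℕ → Carrier
        f i = altSign i * (ρ^ i) y
        ρ-term : ∀ i → ρ (f i) ≈ - f (suc i)
        ρ-term i = begin
          ρ (f i)                             ≈⟨ *-homo _ _ ⟩
          ρ (altSign i) * (ρ^ suc i) y        ≈⟨ *-congʳ (ρ-altSign i) ⟩
          altSign i * (ρ^ suc i) y            ≈⟨ -‿involutive _ ⟨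
          - - (altSign i * (ρ^ suc i) y)      ≈⟨ -‿cong (-‿distribˡ-* _ _) ⟩
          - (altSign (suc i) * (ρ^ suc i) y)  ∎

    order-odd : (∀ x → ρ x ≈ - x → x ≈ 0#) → t % 2 ≡ 1
    order-odd ρx≈-x⇒x≈0 with parity t
    ... | inj₂ t-odd  = t-odd
    ... | inj₁ t-even = ⊥-elim (1≉0 (dedekindIndependence ρ^_ ρ^-* ρ^-1 t ρ^-distinct altSign
            (λ y → ρx≈-x⇒x≈0 _ (ρ-alternatingSum t-even y)) 0 (proj₁ order)))

    module OddOrder (t-odd : t % 2 ≡ 1) (two≉0 : ¬ (1# + 1# ≈ 0#)) where
      private
        a : ℕ → Carrier
        a = coeff F t

      S : Carrier → Carrier
      S = formulaSum F ρ t

      S-cong : ∀ {x y} → x ≈ y → S x ≈ S y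
      S-cong x≈y = ∑-cong t (λ i → *-congˡ (ρ^-cong i x≈y))

      S-+ : ∀ x y → S (x + y) ≈ S x + S y
      S-+ x y = trans (∑-cong t (λ i → trans (*-congˡ (ρ^-+ i x y)) (distribˡ _ _ _))) (∑-+ t _ _)

      ρ-S : ∀ x → ρ (S x) ≈ S (ρ x)
      ρ-S x = trans (ρ-∑ t _) (∑-cong t λ i →
        trans (*-homo _ _) (*-cong (ρ-sign (pos F (t % 4) (i % 4))) (reflexive (≡.sym (ρ^-ρ i x)))))

      ρ²-S : ∀ x → ρ (ρ (S x)) ≈ S (ρ (ρ x))
      ρ²-S x = trans (⟦⟧-cong (ρ-S x)) (ρ-S (ρ x))

      S+ρ²S : ∀ v → S v + ρ (ρ (S v)) ≈ ρ v + ρ v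
      S+ρ²S v = begin
        S v + ρ (ρ (S v))                         ≈⟨ +-congˡ (ρ²-S v) ⟩
        S v + S (ρ (ρ v))                         ≈⟨ ∑-+ t _ _ ⟨
        ∑ t (λ i → g i + a i * (ρ^ i) (ρ (ρ v)))  ≈⟨ ∑-cong t (λ i → +-congˡ (shift i)) ⟩
        ∑ t (λ i → g i - g (suc (suc i)))         ≈⟨ ∑-telescope₂ t g ⟩
        (g 0 - g t) + (g 1 - g (suc t))           ≈⟨ +-cong (x≈y⇒x∙y⁻¹≈ε g0≈gt) g1-g1+t ⟩
        0# + (ρ v + ρ v)                          ≈⟨ +-identityˡ _ ⟩
        ρ v + ρ v                                 ∎
        where
          g : ℕ → Carrier
          g i = a i * (ρ^ i) v
          shift : ∀ i → a i * (ρ^ i) (ρ (ρ v)) ≈ - g (suc (suc i))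
          shift i = begin
            a i * (ρ^ i) (ρ (ρ v))                ≡⟨ ≡.cong (a i *_) (≡.trans (ρ^-ρ i (ρ v)) (≡.cong ρ (ρ^-ρ i v))) ⟩
            a i * (ρ^ suc (suc i)) v              ≈⟨ -‿involutive _ ⟨
            - - (a i * (ρ^ suc (suc i)) v)        ≈⟨ -‿cong (-‿distribˡ-* _ _) ⟩
            - (- a i * (ρ^ suc (suc i)) v)        ≈⟨ -‿cong (*-congʳ (coeff-2+ t t-odd i)) ⟨
            - g (suc (suc i))                     ∎
          g0≈gt : g 0 ≈ g t
          g0≈gt = sym (*-cong (coeff-t t t-odd) (period v))
          g1-g1+t : g 1 - g (suc t) ≈ ρ v + ρ v
          g1-g1+t = begin
            g 1 - g (suc t)        ≈⟨ +-cong (*-congʳ (coeff-1 t t-odd))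
                                              (-‿cong (*-cong (coeff-1+t t t-odd) (⟦⟧-cong (period v)))) ⟩
            1# * ρ v - - 1# * ρ v  ≈⟨ +-cong (*-identityˡ _) (-‿cong (-1*x≈-x _)) ⟩
            ρ v - - ρ v            ≈⟨ +-congˡ (-‿involutive _) ⟩
            ρ v + ρ v              ∎

      half : Carrier
      half = ((1# + 1#) ⁻¹) two≉0

      half-double : ∀ x → half * (x + x) ≈ x
      half-double x = begin
        half * (x + x)              ≈⟨ *-congˡ (trans (distribʳ x 1# 1#) (+-cong (*-identityˡ x) (*-identityˡ x))) ⟨
        half * ((1# + 1#) * x)      ≈⟨ *-assoc _ _ x ⟨
        (half * (1# + 1#)) * x      ≈⟨ *-congʳ (trans (*-comm _ _) (inverseʳ _ two≉0)) ⟩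
        1# * x                      ≈⟨ *-identityˡ x ⟩
        x                           ∎

      ρ-half : ρ half ≈ half
      ρ-half = ρ-inverse two≉0 (trans (+-homo 1# 1#) (+-cong 1#-homo 1#-homo))

      α : Carrier → Carrier
      α u = ρ⁻¹ u + ρ u

      β : Carrier → Carrier
      β v = half * S v

      ρ-α : ∀ w → ρ (α w) ≈ w + ρ (ρ w)
      ρ-α w = trans (+-homo _ _) (+-congʳ (invʳ w))

      ρ-β : ∀ v → ρ (β v) ≈ β (ρ v)
      ρ-β v = trans (*-homo _ _) (*-cong ρ-half (ρ-S v))

      β-+ : ∀ x y → β (x + y) ≈ β x + β y
      β-+ x y = trans (*-congˡ (S-+ x y)) (distribˡ half _ _)

      β+βρ² : ∀ w → β w + β (ρ (ρ w)) ≈ ρ w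
      β+βρ² w = begin
        β w + β (ρ (ρ w))          ≈⟨ distribˡ half _ _ ⟨
        half * (S w + S (ρ (ρ w))) ≈⟨ *-congˡ (+-congˡ (ρ²-S w)) ⟨
        half * (S w + ρ (ρ (S w))) ≈⟨ *-congˡ (S+ρ²S w) ⟩
        half * (ρ w + ρ w)         ≈⟨ half-double (ρ w) ⟩
        ρ w                        ∎

      α∘β : ∀ v → α (β v) ≈ v
      α∘β v = ρ-injective order (begin
        ρ (α (β v))             ≈⟨ ρ-α (β v) ⟩
        β v + ρ (ρ (β v))       ≈⟨ +-congˡ (trans (⟦⟧-cong (ρ-β v)) (ρ-β (ρ v))) ⟩
        β v + β (ρ (ρ v))       ≈⟨ β+βρ² v ⟩
        ρ v                     ∎)

      β∘α : ∀ u → β (α u) ≈ u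
      β∘α u = ρ-injective order (begin
        ρ (β (α u))             ≈⟨ ρ-β (α u) ⟩
        β (ρ (α u))             ≈⟨ *-congˡ (S-cong (ρ-α u)) ⟩
        β (u + ρ (ρ u))         ≈⟨ β-+ u _ ⟩
        β u + β (ρ (ρ u))       ≈⟨ β+βρ² u ⟩
        ρ u                     ∎)

lemma3p6 : {c ℓ : Level} (q : ℕ) (F : FiniteField c ℓ q) → q % 2 ≡ 1 →
    (A : Automorphism F) →
    let open FiniteField F
        open Automorphism A
        α = λ u → ρ⁻¹ u + ρ u
    in ¬ (∀ x → ρ x ≈ x) →
       (∀ x (nz : ¬ (x ≈ 0#)) → ¬ (ρ x * (x ⁻¹) nz ≈ - 1#)) →
       (t : ℕ) → IsOrder F ρ t →
       (t % 2 ≡ 1) ×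
       Σ (¬ (1# + 1# ≈ 0#)) (λ two≉0 →
         let β = λ v → ((1# + 1#) ⁻¹) two≉0 * formulaSum F ρ t v
         in (∀ v → α (β v) ≈ v) × (∀ u → β (α u) ≈ u))
lemma3p6 q F _ A _ no-ratio-1 t order = t-odd , two≉0 , α∘β , β∘α
  where
    open FiniteField F
    open Automorphism A
    open AutomorphismProperties A
    open Order order

    no-anti-fixed : ∀ x → ρ x ≈ - x → x ≈ 0#
    no-anti-fixed = ρx≈-x⇒x≈0 no-ratio-1

    t-odd : t % 2 ≡ 1
    t-odd = order-odd no-anti-fixed

    two≉0 : ¬ (1# + 1# ≈ 0#)
    two≉0 = 1+1≉0 no-anti-fixed

    open OddOrder t-odd two≉0
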